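{- Let $\lambda$ be a mancala configuration of mass $n$, let $k$ be the largest integer such that $\lambda\ge M^k$, and write $n=T_k+r$. If $\lambda$ is $r$-monotone, then $\lambda$ is an augmented marching group.
   Context: $T_j=j(j+1)/2$. A mancala configuration is $\lambda:\mathbb N^*\to\mathbb N$ with support $\{1,\dots,\ell(\lambda)\}$; mass $\sum\lambda_i$. Marching group $M^j_i=j-i+1$ for $i\le j$, $0$ otherwise; componentwise order, $\lambda<\mu$ meaning $\lambda\le\mu$, $\lambda\ne\mu$. An augmented marching group is a mancala $\lambda$ with $M^j\le\lambda<M^{j+1}$ for some $j\ge0$. Energy sequence: $m=\max\{\lambda_1,\ell(\lambda)\}$, $e_i=\lambda_i+i-1$ for $1\le i\le m$, extended $m$-periodically to $\mathbb Z$. For $s\ge1$, $\lambda$ is $s$-monotone if $\lambda_1\le\ell(\lambda)+1$ and $e_j\le e_i+1$ for all integers $i<j\le i+s$; every configuration is $0$-monotone. -}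

module Defs where

open import Data.Nat using (ℕ; zero; suc; _+_; _∸_; _≤_; _<_; _⊔_)
open import Data.Integer as ℤ using (ℤ; +_; _%ℕ_)
open import Data.List using (List; []; _∷_; length)
open import Data.Nat.ListAction using (sum)
open import Data.List.Relation.Unary.All using (All)
open import Data.Product using (Σ; ∃; _×_)
open import Data.Sum using (_⊎_)
open import Relation.Binary.PropositionalEquality using (_≡_)
open import Relation.Nullary using (¬_)

T : ℕ → ℕ
T zero    = 0
T (suc j) = suc j + T j

-- A function ℕ* → ℕ is represented as ℕ → ℕ; the value at 0 is ignored
-- (all comparisons below only look at indices i ≥ 1).
Fun : Set
Fun = ℕ → ℕ

-- A mancala configuration is given by the list (λ₁, …, λ_ℓ) of its
-- (positive) values on its support {1,…,ℓ}.
IsMancala : List ℕ → Set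
IsMancala l = All (0 <_) l

entry : List ℕ → Fun
entry l         zero          = 0
entry []        (suc i)       = 0
entry (x ∷ l)   (suc zero)    = x
entry (x ∷ l)   (suc (suc i)) = entry l (suc i)

ℓ : List ℕ → ℕ
ℓ = length

mass : List ℕ → ℕ
mass = sum

-- Marching group M^j : M^j_i = j - i + 1 for 1 ≤ i ≤ j, 0 for i > j
M : ℕ → Fun
M j i = suc j ∸ i

_≤ᶠ_ : Fun → Fun → Set
f ≤ᶠ g = ∀ i → 1 ≤ i → f i ≤ g i

_≡ᶠ_ : Fun → Fun → Set
f ≡ᶠ g = ∀ i → 1 ≤ i → f i ≡ g i

_<ᶠ_ : Fun → Fun → Set
f <ᶠ g = f ≤ᶠ g × ¬ (f ≡ᶠ g)

IsAugmentedMarchingGroup : List ℕ → Set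
IsAugmentedMarchingGroup l = ∃ λ j → M j ≤ᶠ entry l × entry l <ᶠ M (suc j)

energyPeriod : List ℕ → ℕ
energyPeriod l = entry l 1 ⊔ ℓ l

-- energy sequence: e_t = λ_t + t - 1 for 1 ≤ t ≤ m, extended m-periodically
-- to ℤ, i.e. e_i = e_t with t = ((i - 1) mod m) + 1.
-- (When m = 0, i.e. the empty configuration, the sequence is irrelevant; set to 0.)
energyAux : List ℕ → ℕ → ℤ → ℕ
energyAux l zero    i = 0
energyAux l (suc m) i = entry l (suc r) + r
  where r = (i ℤ.- ℤ.1ℤ) %ℕ suc m

energy : List ℕ → ℤ → ℕ
energy l = energyAux l (energyPeriod l)

-- s-monotone (s ≥ 1): λ₁ ≤ ℓ(λ)+1 and e_j ≤ e_i + 1 for all integers i < j ≤ i + s;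
-- every configuration is 0-monotone.
Monotone : ℕ → List ℕ → Set
Monotone s l = s ≡ 0 ⊎
  (entry l 1 ≤ suc (ℓ l) ×
   (∀ (i j : ℤ) → i ℤ.< j → j ℤ.≤ i ℤ.+ + s → energy l j ≤ suc (energy l i)))

module Submission where

-- Write λ = M^k + δ with δ ≥ 0; comparing masses, δ has total mass r.  Since M^{k+1} ≰ λ, there is a
-- pit: a position i ≤ k + 1 with λ_i = M^k_i, where the energy is k.  A position j with λ_j > M^{k+1}_j
-- lies in the support and has energy at least k + 2.  Going back from j to the nearest pit, cyclically
-- with period m, every position passed has δ ≥ 1 (a non-pit i in the support has λ_i > M^k_i), so that
-- pit is within distance r of j and r-monotonicity bounds the energy at j by k + 1.  If there is no pit
-- before j, the last pit q ≤ m is reached through q+1, …, m−1 and 1, …, j; position m may have δ = 0,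
-- but then j ≤ k and δ_j ≥ 2 makes up for it.

open import Defs
open import Data.Nat using (ℕ; zero; suc; _+_; _∸_; _≤_; _<_; z≤n; s≤s; z<s; _≤?_; _<?_)
open import Data.Nat.Properties
open import Algebra.Properties.CommutativeSemigroup +-commutativeSemigroup using (interchange; x∙yz≈y∙xz)
open import Data.Nat.DivMod using (m<n⇒m%n≡m; [m+n]%n≡m%n)
open import Data.Integer as ℤ using (ℤ)
open import Data.List using (List; []; _∷_)
open import Data.List.Relation.Unary.All using (_∷_)
open import Data.Product using (∃; _×_; _,_; proj₁; proj₂)
open import Data.Sum using (_⊎_; inj₁; inj₂)
open import Data.Empty using (⊥)
open import Relation.Nullary using (¬_; yes; no; contradiction)
open import Relation.Nullary.Decidable using (_×-dec_)
open import Relation.Unary using (Decidable)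
open import Relation.Binary.PropositionalEquality

¬-below-suc : ∀ {P : ℕ → Set} {n} → ¬ P n → ∀ c → (c < n → ¬ P c) → c < suc n → ¬ P c
¬-below-suc ¬Pn c below c<1+n with m≤n⇒m<n∨m≡n (≤-pred c<1+n)
... | inj₁ c<n = below c<n
... | inj₂ refl = ¬Pn

lastBelow : ∀ {P : ℕ → Set} → Decidable P → ∀ n →
  (∃ λ i → i < n × P i × (∀ c → i < c → c < n → ¬ P c)) ⊎ (∀ c → c < n → ¬ P c)
lastBelow P? zero = inj₂ λ _ ()
lastBelow P? (suc n) with P? n
... | yes Pn = inj₁ (n , ≤-refl , Pn , λ c n<c c<1+n → contradiction (≤-pred c<1+n) (<⇒≱ n<c))
... | no ¬Pn with lastBelow P? n
...   | inj₁ (i , i<n , Pi , after) =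
        inj₁ (i , m<n⇒m<1+n i<n , Pi , λ c i<c → ¬-below-suc ¬Pn c (after c i<c))
...   | inj₂ none = inj₂ λ c → ¬-below-suc ¬Pn c (none c)

m∸n≤1+m∸[1+n] : ∀ m n → m ∸ n ≤ suc (m ∸ suc n)
m∸n≤1+m∸[1+n] zero    zero    = z≤n
m∸n≤1+m∸[1+n] (suc m) zero    = ≤-refl
m∸n≤1+m∸[1+n] zero    (suc n) = z≤n
m∸n≤1+m∸[1+n] (suc m) (suc n) = m∸n≤1+m∸[1+n] m n

sumFrom : (ℕ → ℕ) → ℕ → ℕ → ℕ
sumFrom f a zero    = 0
sumFrom f a (suc n) = f a + sumFrom f (suc a) n

module _ (f : ℕ → ℕ) where

  sumFrom-++ : ∀ a m n → sumFrom f a (m + n) ≡ sumFrom f a m + sumFrom f (a + m) n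
  sumFrom-++ a zero    n = cong (λ b → sumFrom f b n) (sym (+-identityʳ a))
  sumFrom-++ a (suc m) n rewrite sumFrom-++ (suc a) m n | +-suc a m = sym (+-assoc (f a) _ _)

  sumFrom-mono-length : ∀ a {m n} → m ≤ n → sumFrom f a m ≤ sumFrom f a n
  sumFrom-mono-length a {m} {n} m≤n = begin
    sumFrom f a m                                        ≤⟨ m≤m+n _ _ ⟩
    sumFrom f a m + sumFrom f (a + m) (n ∸ m)            ≡⟨ sym (sumFrom-++ a m (n ∸ m)) ⟩
    sumFrom f a (m + (n ∸ m))                            ≡⟨ cong (sumFrom f a) (m+[n∸m]≡n m≤n) ⟩
    sumFrom f a n                                        ∎
    where open ≤-Reasoning

  length≤sumFrom : ∀ a n → (∀ c → a ≤ c → c < a + n → 1 ≤ f c) → n ≤ sumFrom f a n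
  length≤sumFrom a zero    _   = z≤n
  length≤sumFrom a (suc n) pos = +-mono-≤ (pos a ≤-refl (m<m+n a z<s))
    (length≤sumFrom (suc a) n λ c a<c c<1+a+n → pos c (<⇒≤ a<c) (subst (c <_) (sym (+-suc a n)) c<1+a+n))

  ∸≤sumFrom : ∀ a b → (∀ c → a ≤ c → c < b → 1 ≤ f c) → b ∸ a ≤ sumFrom f a (b ∸ a)
  ∸≤sumFrom a b pos with a ≤? b
  ... | yes a≤b = length≤sumFrom a (b ∸ a) λ c a≤c c<a+[b∸a] →
                    pos c a≤c (subst (c <_) (m+[n∸m]≡n a≤b) c<a+[b∸a])
  ... | no  a≰b = subst (λ n → n ≤ sumFrom f a n) (sym (m≤n⇒m∸n≡0 (<⇒≤ (≰⇒> a≰b)))) z≤n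

  sumFrom-snoc : ∀ a n → sumFrom f a (suc n) ≡ sumFrom f a n + f (a + n)
  sumFrom-snoc a n = begin
    sumFrom f a (suc n)                         ≡⟨ cong (sumFrom f a) (+-comm 1 n) ⟩
    sumFrom f a (n + 1)                         ≡⟨ sumFrom-++ a n 1 ⟩
    sumFrom f a n + (f (a + n) + 0)             ≡⟨ cong (sumFrom f a n +_) (+-identityʳ (f (a + n))) ⟩
    sumFrom f a n + f (a + n)                   ∎
    where open ≡-Reasoning

  sumFrom-vanishes : ∀ a n → (∀ c → a ≤ c → f c ≡ 0) → sumFrom f a n ≡ 0
  sumFrom-vanishes a zero    _    = refl
  sumFrom-vanishes a (suc n) f≡0 =
    cong₂ _+_ (f≡0 a ≤-refl) (sumFrom-vanishes (suc a) n λ c a<c → f≡0 c (<⇒≤ a<c))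

module _ {f g : ℕ → ℕ} where

  sumFrom-cong : ∀ a n → (∀ c → a ≤ c → f c ≡ g c) → sumFrom f a n ≡ sumFrom g a n
  sumFrom-cong a zero    _  = refl
  sumFrom-cong a (suc n) eq = cong₂ _+_ (eq a ≤-refl) (sumFrom-cong (suc a) n λ c a<c → eq c (<⇒≤ a<c))

  sumFrom-shift : ∀ a n → (∀ c → a ≤ c → f (suc c) ≡ g c) → sumFrom f (suc a) n ≡ sumFrom g a n
  sumFrom-shift a zero    _  = refl
  sumFrom-shift a (suc n) eq = cong₂ _+_ (eq a ≤-refl) (sumFrom-shift (suc a) n λ c a<c → eq c (<⇒≤ a<c))

  sumFrom-+ : ∀ a n → sumFrom (λ c → f c + g c) a n ≡ sumFrom f a n + sumFrom g a n
  sumFrom-+ a zero    = refl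
  sumFrom-+ a (suc n) = trans (cong (f a + g a +_) (sumFrom-+ (suc a) n)) (interchange (f a) (g a) _ _)

rawEnergy : Fun → ℕ → ℕ
rawEnergy f i = f i + (i ∸ 1)

M-suc : ∀ {k i} → i ≤ suc k → M (suc k) i ≡ suc (M k i)
M-suc = +-∸-assoc 1

rawEnergy-above-M : ∀ {f k i} → 1 ≤ i → M k i < f i → suc k ≤ rawEnergy f i
rawEnergy-above-M {f} {k} {suc t} _ M<f = begin
  suc k                  ≤⟨ s≤s (m≤n+m∸n k t) ⟩
  suc (t + (k ∸ t))      ≡⟨ sym (+-suc t (k ∸ t)) ⟩
  t + suc (k ∸ t)        ≤⟨ +-monoʳ-≤ t M<f ⟩
  t + f (suc t)          ≡⟨ +-comm t (f (suc t)) ⟩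
  f (suc t) + t          ∎
  where open ≤-Reasoning

M-support : ∀ {k i} → 0 < M k i → i ≤ k
M-support M>0 = ≤-pred (m∸n≢0⇒n<m (λ M≡0 → <⇒≢ M>0 (sym M≡0)))

rawEnergy-M : ∀ {k i} → 1 ≤ i → i ≤ suc k → rawEnergy (M k) i ≡ k
rawEnergy-M {i = suc i} _ (s≤s i≤k) = m∸n+n≡m i≤k

sumFrom-M : ∀ k x → sumFrom (M k) 1 (k + x) ≡ T k
sumFrom-M zero    x = sumFrom-vanishes (M 0) 1 x λ { (suc c) _ → 0∸n≡0 c }
sumFrom-M (suc k) x = cong (suc k +_) (trans (sumFrom-shift 1 (k + x) λ _ _ → refl) (sumFrom-M k x))

sumFrom-entry : ∀ l x → sumFrom (entry l) 1 (ℓ l + x) ≡ mass l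
sumFrom-entry []      x = sumFrom-vanishes (entry []) 1 x λ { (suc c) _ → refl }
sumFrom-entry (y ∷ l) x =
  cong (y +_) (trans (sumFrom-shift 1 (ℓ l + x) λ { (suc c) _ → refl }) (sumFrom-entry l x))

entry-pos : ∀ {l i} → IsMancala l → 1 ≤ i → i ≤ ℓ l → 1 ≤ entry l i
entry-pos {_ ∷ _} {suc zero}    (p ∷ _)  _ _         = p
entry-pos {_ ∷ l} {suc (suc i)} (_ ∷ ps) _ (s≤s i<ℓ) = entry-pos {l} ps (s≤s z≤n) i<ℓ

entry-support : ∀ l {i} → 1 ≤ entry l i → i ≤ ℓ l
entry-support (_ ∷ _) {suc zero}    _   = s≤s z≤n
entry-support (_ ∷ l) {suc (suc i)} pos = s≤s (entry-support l pos)

energyAux-inPeriod : ∀ l m t → t < m → energyAux l m (ℤ.+ suc t) ≡ rawEnergy (entry l) (suc t)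
energyAux-inPeriod l (suc m) t t<m rewrite m<n⇒m%n≡m t<m = refl

energyAux-periodic : ∀ l m t → energyAux l m (ℤ.+ (suc t + m)) ≡ energyAux l m (ℤ.+ suc t)
energyAux-periodic l zero    t = refl
energyAux-periodic l (suc m) t rewrite [m+n]%n≡m%n t (suc m) ⦃ _ ⦄ = refl

energy-inPeriod : ∀ l {i} → 1 ≤ i → i ≤ energyPeriod l → energy l (ℤ.+ i) ≡ rawEnergy (entry l) i
energy-inPeriod l {suc t} _ t<m = energyAux-inPeriod l (energyPeriod l) t t<m

energy-periodic : ∀ l {i} → 1 ≤ i → energy l (ℤ.+ (i + energyPeriod l)) ≡ energy l (ℤ.+ i)
energy-periodic l {suc t} _ = energyAux-periodic l (energyPeriod l) t

module Excess (l : List ℕ) (mancala : IsMancala l) (k : ℕ) (M≤entry : M k ≤ᶠ entry l)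
              (r : ℕ) (mass≡ : mass l ≡ T k + r) where

  excess : Fun
  excess i = entry l i ∸ M k i

  entry≡M+excess : ∀ {i} → 1 ≤ i → entry l i ≡ M k i + excess i
  entry≡M+excess 1≤i = sym (m+[n∸m]≡n (M≤entry _ 1≤i))

  sumFrom-excess : ∀ x → sumFrom excess 1 (k + (ℓ l + x)) ≡ r
  sumFrom-excess x = +-cancelˡ-≡ (T k) _ _ (begin
    T k + sumFrom excess 1 N                   ≡⟨ cong (_+ sumFrom excess 1 N) (sym (sumFrom-M k (ℓ l + x))) ⟩
    sumFrom (M k) 1 N + sumFrom excess 1 N     ≡⟨ sym (sumFrom-+ 1 N) ⟩
    sumFrom (λ c → M k c + excess c) 1 N       ≡⟨ sumFrom-cong 1 N (λ _ 1≤c → sym (entry≡M+excess 1≤c)) ⟩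
    sumFrom (entry l) 1 N                      ≡⟨ cong (sumFrom (entry l) 1) (x∙yz≈y∙xz k (ℓ l) x) ⟩
    sumFrom (entry l) 1 (ℓ l + (k + x))        ≡⟨ sumFrom-entry l (k + x) ⟩
    mass l                                     ≡⟨ mass≡ ⟩
    T k + r                                    ∎)
    where
    N = k + (ℓ l + x)
    open ≡-Reasoning

  prefix+interval≤r : ∀ {j a} n → j ≤ a → sumFrom excess 1 j + sumFrom excess (suc a) n ≤ r
  prefix+interval≤r {j} {a} n j≤a = begin
    sumFrom excess 1 j + sumFrom excess (suc a) n  ≤⟨ +-monoˡ-≤ _ (sumFrom-mono-length excess 1 j≤a) ⟩
    sumFrom excess 1 a + sumFrom excess (suc a) n  ≡⟨ sym (sumFrom-++ excess 1 a n) ⟩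
    sumFrom excess 1 (a + n)                       ≤⟨ sumFrom-mono-length excess 1 a+n≤N ⟩
    sumFrom excess 1 (k + (ℓ l + (a + n)))         ≡⟨ sumFrom-excess (a + n) ⟩
    r                                              ∎
    where
    a+n≤N : a + n ≤ k + (ℓ l + (a + n))
    a+n≤N = ≤-trans (m≤n+m (a + n) (ℓ l)) (m≤n+m _ k)
    open ≤-Reasoning

  interval≤r : ∀ a n → sumFrom excess (suc a) n ≤ r
  interval≤r a n = prefix+interval≤r n z≤n

  M<entry⇒excess≥1 : ∀ i → M k i < entry l i → 1 ≤ excess i
  M<entry⇒excess≥1 _ = m<n⇒0<n∸m

  -- Given M^k ≤ λ, this says exactly that i ≤ k + 1 and λ_i = M^k_i.
  Pit : ℕ → Set
  Pit i = 1 ≤ i × entry l i < M (suc k) i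

  pit? : Decidable Pit
  pit? i = (1 ≤? i) ×-dec (entry l i <? M (suc k) i)

  pit⇒≤ : ∀ {i} → Pit i → i ≤ suc k
  pit⇒≤ (_ , entry<M) = M-support (≤-trans (s≤s z≤n) entry<M)

  pit-rawEnergy : ∀ {i} → Pit i → rawEnergy (entry l) i ≡ k
  pit-rawEnergy {i} pit@(1≤i , entry<M) = trans (cong (_+ (i ∸ 1)) entry≡M) (rawEnergy-M 1≤i (pit⇒≤ pit))
    where
    entry≡M : entry l i ≡ M k i
    entry≡M = ≤-antisym (≤-pred (subst (entry l i <_) (M-suc (pit⇒≤ pit)) entry<M)) (M≤entry i 1≤i)

  ¬pit⇒excess≥1 : ∀ {i} → 1 ≤ i → i ≤ ℓ l → ¬ Pit i → 1 ≤ excess i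
  ¬pit⇒excess≥1 {i} 1≤i i≤ℓ ¬pit with i ≤? suc k
  ... | yes i≤1+k = M<entry⇒excess≥1 i
                      (subst (_≤ entry l i) (M-suc i≤1+k) (≮⇒≥ λ entry<M → ¬pit (1≤i , entry<M)))
  ... | no  i≰1+k = M<entry⇒excess≥1 i
                      (subst (_< entry l i) (sym (m≤n⇒m∸n≡0 (<⇒≤ (≰⇒> i≰1+k)))) (entry-pos mancala 1≤i i≤ℓ))

  pit-exists : ¬ (M (suc k) ≤ᶠ entry l) → ∃ Pit
  pit-exists notAbove with lastBelow pit? (suc (suc k))
  ... | inj₁ (p , _ , pit , _) = p , pit
  ... | inj₂ none = contradiction above notAbove
    where
    above : M (suc k) ≤ᶠ entry l
    above i 1≤i = ≮⇒≥ λ entry<M → none i (s≤s (pit⇒≤ (1≤i , entry<M))) (1≤i , entry<M)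

  module Overshoot {j} (1≤j : 1 ≤ j) (over : M (suc k) j < entry l j) where

    j≤ℓ : j ≤ ℓ l
    j≤ℓ = entry-support l (≤-trans (s≤s z≤n) over)

    ¬pit : ¬ Pit j
    ¬pit (_ , entry<M) = <-asym over entry<M

    excess≥1 : 1 ≤ excess j
    excess≥1 = M<entry⇒excess≥1 j (≤-<-trans (∸-monoˡ-≤ j (n≤1+n (suc k))) over)

    excess≥2 : j ≤ suc k → 2 ≤ excess j
    excess≥2 j≤1+k = m+n≤o⇒m≤o∸n 2 (subst (_< entry l j) (M-suc j≤1+k) over)

    energy≥ : suc (suc k) ≤ energy l (ℤ.+ j)
    energy≥ = subst (suc (suc k) ≤_) (sym (energy-inPeriod l 1≤j (≤-trans j≤ℓ (m≤n⊔m _ _))))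
                (rawEnergy-above-M {entry l} 1≤j over)

    excess≥1-upTo : ∀ {c} → 1 ≤ c → c ≤ j → (c < j → ¬ Pit c) → 1 ≤ excess c
    excess≥1-upTo 1≤c c≤j ¬pit-below with m≤n⇒m<n∨m≡n c≤j
    ... | inj₁ c<j  = ¬pit⇒excess≥1 1≤c (≤-trans (<⇒≤ c<j) j≤ℓ) (¬pit-below c<j)
    ... | inj₂ refl = excess≥1

  module Monotonic (mono : ∀ (i j : ℤ) → i ℤ.< j → j ℤ.≤ i ℤ.+ ℤ.+ r → energy l j ≤ suc (energy l i)) where

    pit-near : ∀ {a b} → Pit a → a ≤ energyPeriod l → a < b → b ≤ a + r → energy l (ℤ.+ b) ≤ suc k
    pit-near {a} {b} pit a≤m a<b b≤a+r = begin
      energy l (ℤ.+ b)          ≤⟨ mono (ℤ.+ a) (ℤ.+ b) (ℤ.+<+ a<b) (ℤ.+≤+ b≤a+r) ⟩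
      suc (energy l (ℤ.+ a))    ≡⟨ cong suc (trans (energy-inPeriod l (proj₁ pit) a≤m) (pit-rawEnergy pit)) ⟩
      suc k                     ∎
      where open ≤-Reasoning

    pitBefore : ∀ {i j} → 1 ≤ j → M (suc k) j < entry l j →
                Pit i → i < j → (∀ c → i < c → c < j → ¬ Pit c) → ⊥
    pitBefore {i} {j} 1≤j over pit i<j after =
      1+n≰n (≤-trans (Overshoot.energy≥ 1≤j over) (pit-near pit i≤m i<j j≤i+r))
      where
      i≤m : i ≤ energyPeriod l
      i≤m = ≤-trans (<⇒≤ i<j) (≤-trans (Overshoot.j≤ℓ 1≤j over) (m≤n⊔m _ _))
      count : j ∸ i ≤ sumFrom excess (suc i) (j ∸ i)
      count = ∸≤sumFrom excess (suc i) (suc j) λ c i<c c≤j →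
        Overshoot.excess≥1-upTo 1≤j over (≤-trans (s≤s z≤n) i<c) (≤-pred c≤j) (after c i<c)
      j≤i+r : j ≤ i + r
      j≤i+r = subst (_≤ i + r) (m+[n∸m]≡n (<⇒≤ i<j)) (+-monoʳ-≤ i (≤-trans count (interval≤r i (j ∸ i))))

    module NoPitBefore (notAbove : ¬ (M (suc k) ≤ᶠ entry l)) (entry₁≤ : entry l 1 ≤ suc (ℓ l))
                       {t} (over : M (suc k) (suc t) < entry l (suc t)) (none : ∀ c → c < suc t → ¬ Pit c) where

      m j : ℕ
      m = energyPeriod l
      j = suc t

      1≤j : 1 ≤ j
      1≤j = s≤s z≤n

      ¬pit-upTo : ∀ c → c ≤ j → ¬ Pit c
      ¬pit-upTo c c≤j with m≤n⇒m<n∨m≡n c≤j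
      ... | inj₁ c<j  = none c c<j
      ... | inj₂ refl = Overshoot.¬pit 1≤j over

      1+k≤m : suc k ≤ m
      1+k≤m = ≤-trans (≮⇒≥ λ entry<M → ¬pit-upTo 1 1≤j (s≤s z≤n , entry<M)) (m≤m⊔n _ _)

      lastPit : ∃ λ q → q < suc m × Pit q × (∀ c → q < c → c < suc m → ¬ Pit c)
      lastPit with lastBelow pit? (suc m)
      ... | inj₁ found = found
      ... | inj₂ noPit = contradiction pit (noPit p (s≤s (≤-trans (pit⇒≤ pit) 1+k≤m)))
        where
        p = proj₁ (pit-exists notAbove)
        pit = proj₂ (pit-exists notAbove)

      contra : ⊥
      contra with lastPit
      ... | q , q<1+m , pitq , after = 1+n≰n (≤-trans energy≥ (pit-near pitq q≤m q<j+m j+m≤q+r))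
        where
        q≤m : q ≤ m
        q≤m = ≤-pred q<1+m
        j<q : j < q
        j<q = ≰⇒> λ q≤j → ¬pit-upTo q q≤j pitq
        q<j+m : q < j + m
        q<j+m = ≤-<-trans q≤m (m<n+m m 1≤j)
        energy≥ : suc (suc k) ≤ energy l (ℤ.+ (j + m))
        energy≥ = subst (suc (suc k) ≤_) (sym (energy-periodic l 1≤j)) (Overshoot.energy≥ 1≤j over)
        prefixCount : suc j ≤ sumFrom excess 1 j
        prefixCount = begin
          suc j                                   ≡⟨ +-comm 2 t ⟩
          t + 2                                   ≤⟨ +-mono-≤ count (Overshoot.excess≥2 1≤j over j≤1+k) ⟩
          sumFrom excess 1 t + excess j           ≡⟨ sym (sumFrom-snoc excess 1 t) ⟩
          sumFrom excess 1 j                      ∎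
          where
          open ≤-Reasoning
          j≤1+k : j ≤ suc k
          j≤1+k = <⇒≤ (<-≤-trans j<q (pit⇒≤ pitq))
          count : t ≤ sumFrom excess 1 t
          count = ∸≤sumFrom excess 1 j λ c 1≤c c<j →
            ¬pit⇒excess≥1 1≤c (≤-trans (<⇒≤ c<j) (Overshoot.j≤ℓ 1≤j over)) (none c c<j)
        suffixCount : m ∸ suc q ≤ sumFrom excess (suc q) (m ∸ suc q)
        suffixCount = ∸≤sumFrom excess (suc q) m λ c q<c c<m →
          ¬pit⇒excess≥1 (≤-trans (s≤s z≤n) q<c) (≤-pred (≤-trans c<m (⊔-lub entry₁≤ (n≤1+n _))))
                        (after c q<c (m<n⇒m<1+n c<m))
        j+m≤q+r : j + m ≤ q + r
        j+m≤q+r = begin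
          j + m                       ≡⟨ cong (j +_) (sym (m∸n+n≡m q≤m)) ⟩
          j + (m ∸ q + q)             ≡⟨ sym (+-assoc j (m ∸ q) q) ⟩
          j + (m ∸ q) + q             ≤⟨ +-monoˡ-≤ q (+-monoʳ-≤ j (m∸n≤1+m∸[1+n] m q)) ⟩
          j + suc (m ∸ suc q) + q     ≡⟨ cong (_+ q) (+-suc j (m ∸ suc q)) ⟩
          suc j + (m ∸ suc q) + q     ≤⟨ +-monoˡ-≤ q (≤-trans (+-mono-≤ prefixCount suffixCount)
                                                         (prefix+interval≤r (m ∸ suc q) (<⇒≤ j<q))) ⟩
          r + q                       ≡⟨ +-comm r q ⟩
          q + r                       ∎
          where open ≤-Reasoning

  noOvershoot : ¬ (M (suc k) ≤ᶠ entry l) → Monotone r l → ∀ {j} → 1 ≤ j → ¬ (M (suc k) j < entry l j)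
  noOvershoot _ (inj₁ refl) {suc t} 1≤j over =
    1+n≰n (≤-trans (≤-trans (Overshoot.excess≥1 1≤j over) (m≤m+n _ 0)) (interval≤r t 1))
  noOvershoot notAbove (inj₂ (entry₁≤ , mono)) {suc t} 1≤j over with lastBelow pit? (suc t)
  ... | inj₁ (i , i<j , pit , after) = Monotonic.pitBefore mono 1≤j over pit i<j after
  ... | inj₂ none                    = Monotonic.NoPitBefore.contra mono notAbove entry₁≤ over none

mainTheorem18 : (l : List ℕ) → IsMancala l →
    (k : ℕ) → M k ≤ᶠ entry l → (∀ j → M j ≤ᶠ entry l → j ≤ k) →
    (r : ℕ) → mass l ≡ T k + r →
    Monotone r l → IsAugmentedMarchingGroup l
mainTheorem18 l mancala k M≤entry maximal r mass≡ monotone = k , M≤entry , entry≤M , entry≢M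
  where
  notAbove : ¬ (M (suc k) ≤ᶠ entry l)
  notAbove M≤ = 1+n≰n (maximal (suc k) M≤)
  entry≤M : entry l ≤ᶠ M (suc k)
  entry≤M i 1≤i = ≮⇒≥ (Excess.noOvershoot l mancala k M≤entry r mass≡ notAbove monotone 1≤i)
  entry≢M : ¬ (entry l ≡ᶠ M (suc k))
  entry≢M eq = notAbove λ i 1≤i → ≤-reflexive (sym (eq i 1≤i))
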